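{- Let $w,h\ge 1$ be integers and let $G=P_w(U)\sqcap P_h$ for a root set $U\subseteq\{1,\dots,w\}$. 1. If $U=\{1\}$ or $U=\{w\}$, then $Z(G)\le \lceil h/2\rceil$. 2. If $U=\{i\}$ with $i\neq 1$ and $i\neq w$, then $Z(G)\le h$.
   Context: All graphs are finite, simple and undirected. The path $P_n$ has vertex set $\{1,\dots,n\}$ and edges $\{k,k+1\}$ for $1\le k\le n-1$. For graphs $W,H$ and a subset $U\subseteq V(W)$ (the root set), the (generalized) hierarchical product $W(U)\sqcap H$ is the graph with vertex set $V(W)\times V(H)$ in which $(x_1,y_1)$ and $(x_2,y_2)$ are adjacent if and only if either ($x_1=x_2\in U$ and $y_1y_2\in E(H)$) or ($y_1=y_2$ and $x_1x_2\in E(W)$). Zero forcing: starting from a set $S$ of filled vertices, repeatedly apply the color change rule: if a filled vertex has exactly one unfilled neighbor, that neighbor becomes filled. $S$ is a zero forcing set if this eventually fills every vertex. The zero forcing number $Z(G)$ is the minimum size of a zero forcing set of $G$. -}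

module Defs where

open import Data.Nat using (ℕ; zero; suc; _≤_)
open import Data.Fin using (Fin; toℕ)
open import Data.Product using (_×_; _,_; ∃-syntax)
open import Data.Sum using (_⊎_)
open import Data.List using (List; length)
open import Data.List.Membership.Propositional using (_∈_)
open import Relation.Binary.PropositionalEquality using (_≡_; _≢_)

-- Path P_n on vertices Fin n (vertex k of the paper is Fin index k-1);
-- edges {k, k+1}.
PathAdj : (n : ℕ) → Fin n → Fin n → Set
PathAdj n a b = (toℕ b ≡ suc (toℕ a)) ⊎ (toℕ a ≡ suc (toℕ b))

HProdAdj : {VW VH : Set} → (VW → VW → Set) → (VW → Set) → (VH → VH → Set)
         → (VW × VH) → (VW × VH) → Set
HProdAdj W U H (x₁ , y₁) (x₂ , y₂) =
  ((x₁ ≡ x₂) × U x₁ × H y₁ y₂) ⊎ ((y₁ ≡ y₂) × W x₁ x₂)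

data Filled {V : Set} (Adj : V → V → Set) (S : List V) : V → Set where
  initial : ∀ {v} → v ∈ S → Filled Adj S v
  force   : ∀ {u v} → Filled Adj S u → Adj u v
          → (∀ x → Adj u x → x ≢ v → Filled Adj S x)
          → Filled Adj S v

IsZeroForcingSet : {V : Set} → (V → V → Set) → List V → Set
IsZeroForcingSet Adj S = ∀ v → Filled Adj S v

-- Z(G) ≤ k  :⇔  G has a zero forcing set with at most k vertices.
-- (A list with repetitions only overcounts, so list length ≤ k is harmless.)
ZeroForcingNumber≤ : {V : Set} → (V → V → Set) → ℕ → Set
ZeroForcingNumber≤ Adj k = ∃[ S ] (length S ≤ k × IsZeroForcingSet Adj S)

PathHProdSingleton : (w h : ℕ) → Fin w → (Fin w × Fin h) → (Fin w × Fin h) → Set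
PathHProdSingleton w h i = HProdAdj (PathAdj w) (λ x → x ≡ i) (PathAdj h)

-- Root at the first column: seed the last column in the even rows. Every
-- non-root vertex has only horizontal neighbours, so each even row fills
-- from right to left on its own. Then, going up, an odd row is entered at
-- the root column from the even row below (whose other neighbours are
-- already filled) and swept left to right; the vertical neighbours met at
-- the root lie in the row below or in an even row. Reflecting the path
-- moves the root to the last column. For an arbitrary root, seeding the
-- whole first column lets each column force the next one.
module Submission where

open import Defs
open import Data.Nat using (ℕ; zero; suc; _≤_; _<_; _∸_; ⌈_/2⌉; z<s; s<s; parity)
open import Data.Nat.Induction using (<-wellFounded)
open import Data.Nat.Properties using (<-trans; ≤-reflexive; suc-injective; ∸-monoʳ-<)
open import Data.Parity.Base using (0ℙ; 1ℙ; _⁻¹)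
open import Data.Parity.Properties using (suc-homo-⁻¹; ⁻¹-selfInverse)
open import Data.Fin using (Fin; zero; suc; toℕ; fromℕ; inject₁; opposite)
open import Data.Fin.Properties
  using ( toℕ-injective; toℕ-fromℕ; toℕ-inject₁; toℕ<n
        ; opposite-prop; opposite-involutive; ≤̄⇒inject₁<)
  renaming (≤-refl to Fin-≤-refl)
open import Data.Product using (_×_; _,_; proj₁; ∃-syntax; map₁) renaming (map to ×-map)
open import Data.Product.Relation.Binary.Lex.Strict using (×-Lex; ×-wellFounded)
open import Data.Sum using (_⊎_; inj₁; inj₂; [_,_]′; swap) renaming (map to ⊎-map)
open import Data.List using (List; []; _∷_; map; length; allFin)
open import Data.List.Properties using (length-map; length-tabulate)
open import Data.List.Membership.Propositional using (_∈_)
open import Data.List.Membership.Propositional.Properties using (∈-map⁺; ∈-allFin)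
open import Data.List.Relation.Unary.Any using (here; there)
open import Data.Empty using (⊥-elim)
open import Function using (_∘_; _on_)
open import Induction.WellFounded using (WellFounded; module All)
import Relation.Binary.Construct.On as On
open import Relation.Binary.PropositionalEquality

private
  variable
    n w h : ℕ

record EarlierForce {V R : Set} (_≺_ : R → R → Set) (Adj : V → V → Set)
                    (rank : V → R) (v : V) : Set where
  field
    forcer         : V
    forcer-adj     : Adj forcer v
    forcer-earlier : rank forcer ≺ rank v
    others-earlier : ∀ x → Adj forcer x → x ≡ v ⊎ rank x ≺ rank v

zeroForcingSet-byRank : {V R : Set} {_≺_ : R → R → Set} {Adj : V → V → Set} {S : List V}
  → WellFounded _≺_ → (rank : V → R)
  → (∀ v → v ∈ S ⊎ EarlierForce _≺_ Adj rank v)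
  → IsZeroForcingSet Adj S
zeroForcingSet-byRank {_≺_ = _≺_} {Adj} {S} wf rank schedule =
  All.wfRec (On.wellFounded rank wf) _ (Filled Adj S) filled
  where
  filled : ∀ v → (∀ {u} → (_≺_ on rank) u v → Filled Adj S u) → Filled Adj S v
  filled v ih with schedule v
  ... | inj₁ v∈S = initial v∈S
  ... | inj₂ f = force (ih forcer-earlier) forcer-adj
                   λ x u~x x≢v → [ ⊥-elim ∘ x≢v , ih ]′ (others-earlier x u~x)
    where open EarlierForce f

module _ {V V′ : Set} {A : V → V → Set} {B : V′ → V′ → Set}
         (f : V → V′) (g : V′ → V)
         (g∘f : ∀ v → g (f v) ≡ v) (f∘g : ∀ v → f (g v) ≡ v)
         (f-adj : ∀ {u v} → A u v → B (f u) (f v))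
         (g-adj : ∀ {u v} → B u v → A (g u) (g v)) where

  Filled-map : ∀ {S v} → Filled A S v → Filled B (map f S) (f v)
  Filled-map (initial v∈S) = initial (∈-map⁺ f v∈S)
  Filled-map {S} (force {u} u-filled u~v others) =
    force (Filled-map u-filled) (f-adj u~v) λ x fu~x x≢fv →
      subst (Filled B (map f S)) (f∘g x)
        (Filled-map (others (g x) (subst (λ u′ → A u′ (g x)) (g∘f u) (g-adj fu~x))
                                  (λ gx≡v → x≢fv (trans (sym (f∘g x)) (cong f gx≡v)))))

  ZeroForcingNumber≤-iso : ∀ {k} → ZeroForcingNumber≤ A k → ZeroForcingNumber≤ B k
  ZeroForcingNumber≤-iso {k} (S , |S|≤k , S-forces) =
    map f S , subst (_≤ k) (sym (length-map f S)) |S|≤k ,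
    λ v → subst (Filled B (map f S)) (f∘g v) (Filled-map (S-forces (g v)))

HProdAdj-map₁ : {VW VH : Set} {W : VW → VW → Set} {U U′ : VW → Set} {H : VH → VH → Set}
  (σ : VW → VW) → (∀ {a b} → W a b → W (σ a) (σ b)) → (∀ {a} → U a → U′ (σ a))
  → ∀ {u v} → HProdAdj W U H u v → HProdAdj W U′ H (map₁ σ u) (map₁ σ v)
HProdAdj-map₁ σ σ-adj σ-root {_ , _} {_ , _} (inj₁ (refl , root , y~y′)) =
  inj₁ (refl , σ-root root , y~y′)
HProdAdj-map₁ σ σ-adj σ-root {_ , _} {_ , _} (inj₂ (refl , x~x′)) = inj₂ (refl , σ-adj x~x′)

inject₁<suc : (c : Fin n) → toℕ (inject₁ c) < toℕ (suc c)
inject₁<suc c = ≤̄⇒inject₁< Fin-≤-refl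

PathAdj-sym : {a b : Fin n} → PathAdj n a b → PathAdj n b a
PathAdj-sym = swap

PathAdj-inject₁-suc : (c : Fin n) → PathAdj (suc n) (inject₁ c) (suc c)
PathAdj-inject₁-suc c = inj₁ (cong suc (sym (toℕ-inject₁ c)))

PathAdj-inject₁ : {c : Fin n} {b : Fin (suc n)}
  → PathAdj (suc n) (inject₁ c) b → b ≡ suc c ⊎ toℕ b < toℕ (inject₁ c)
PathAdj-inject₁ {c = c} (inj₁ b≡c+1) =
  inj₁ (toℕ-injective (trans b≡c+1 (cong suc (toℕ-inject₁ c))))
PathAdj-inject₁ (inj₂ c≡b+1) = inj₂ (≤-reflexive (sym c≡b+1))

PathAdj-suc : {c : Fin n} {b : Fin (suc n)}
  → PathAdj (suc n) (suc c) b → b ≡ inject₁ c ⊎ toℕ (suc c) < toℕ b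
PathAdj-suc (inj₁ b≡c+2) = inj₂ (≤-reflexive (sym b≡c+2))
PathAdj-suc {c = c} (inj₂ c+1≡b+1) =
  inj₁ (toℕ-injective (trans (sym (suc-injective c+1≡b+1)) (sym (toℕ-inject₁ c))))

opposite-inject₁ : (c : Fin n) → opposite (inject₁ c) ≡ suc (opposite c)
opposite-inject₁ {suc n} zero = refl
opposite-inject₁ {suc n} (suc c) = cong inject₁ (opposite-inject₁ c)

opposite-reverses-< : {a b : Fin n} → toℕ a < toℕ b → toℕ (opposite b) < toℕ (opposite a)
opposite-reverses-< {a = a} {b} a<b rewrite opposite-prop a | opposite-prop b =
  ∸-monoʳ-< (s<s a<b) (toℕ<n b)

opposite-reverses-suc : {a b : Fin n}
  → toℕ b ≡ suc (toℕ a) → toℕ (opposite a) ≡ suc (toℕ (opposite b))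
opposite-reverses-suc {a = a} {suc c} b≡a+1
  with refl ← toℕ-injective {i = a} {inject₁ c}
                (trans (sym (suc-injective b≡a+1)) (sym (toℕ-inject₁ c))) =
  trans (cong toℕ (opposite-inject₁ c)) (cong suc (sym (toℕ-inject₁ (opposite c))))

PathAdj-opposite : {a b : Fin n} → PathAdj n a b → PathAdj n (opposite a) (opposite b)
PathAdj-opposite = swap ∘ ⊎-map opposite-reverses-suc opposite-reverses-suc

fromℕ-or-inject₁ : (x : Fin (suc n)) → x ≡ fromℕ n ⊎ ∃[ c ] x ≡ inject₁ c
fromℕ-or-inject₁ {zero} zero = inj₁ refl
fromℕ-or-inject₁ {suc n} zero = inj₂ (zero , refl)
fromℕ-or-inject₁ {suc n} (suc x) = ⊎-map (cong suc) (×-map suc (cong suc)) (fromℕ-or-inject₁ x)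

evenFins : (h : ℕ) → List (Fin h)
evenFins zero = []
evenFins (suc zero) = zero ∷ []
evenFins (suc (suc h)) = zero ∷ map (λ y → suc (suc y)) (evenFins h)

length-evenFins : ∀ h → length (evenFins h) ≡ ⌈ h /2⌉
length-evenFins zero = refl
length-evenFins (suc zero) = refl
length-evenFins (suc (suc h)) = cong suc (trans (length-map _ (evenFins h)) (length-evenFins h))

∈-evenFins : (y : Fin h) → parity (toℕ y) ≡ 0ℙ → y ∈ evenFins h
∈-evenFins {suc zero} zero _ = here refl
∈-evenFins {suc (suc h)} zero _ = here refl
∈-evenFins {suc (suc h)} (suc zero) ()
∈-evenFins {suc (suc h)} (suc (suc y)) even = there (∈-map⁺ _ (∈-evenFins y even))

odd⇒suc-even : ∀ n → parity n ≡ 1ℙ → parity (suc n) ≡ 0ℙ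
odd⇒suc-even n odd = sym (⁻¹-selfInverse (trans (suc-homo-⁻¹ n) odd))

suc-odd⇒even : ∀ n → parity (suc n) ≡ 1ℙ → parity n ≡ 0ℙ
suc-odd⇒even n odd = trans (sym (suc-homo-⁻¹ n)) (cong _⁻¹ odd)

firstColumn : (w h : ℕ) → List (Fin (suc w) × Fin h)
firstColumn w h = map (zero ,_) (allFin h)

firstColumn-zeroForcing : (i : Fin (suc w))
  → IsZeroForcingSet (PathHProdSingleton (suc w) h i) (firstColumn w h)
firstColumn-zeroForcing {w} {h} i = zeroForcingSet-byRank <-wellFounded (toℕ ∘ proj₁) scheduled
  where
  scheduled : ∀ v
    → v ∈ firstColumn w h ⊎ EarlierForce _<_ (PathHProdSingleton (suc w) h i) (toℕ ∘ proj₁) v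
  scheduled (zero , y) = inj₁ (∈-map⁺ _ (∈-allFin y))
  scheduled (suc c , y) = inj₂ record
    { forcer         = inject₁ c , y
    ; forcer-adj     = inj₂ (refl , PathAdj-inject₁-suc c)
    ; forcer-earlier = inject₁<suc c
    ; others-earlier = others
    }
    where
    others : ∀ v → PathHProdSingleton (suc w) h i (inject₁ c , y) v
      → v ≡ (suc c , y) ⊎ toℕ (proj₁ v) < suc (toℕ c)
    others _ (inj₁ (refl , _ , _)) = inj₂ (inject₁<suc c)
    others _ (inj₂ (refl , c~b)) =
      ⊎-map (cong (_, y)) (λ b<c → <-trans b<c (inject₁<suc c)) (PathAdj-inject₁ c~b)

ZeroForcingNumber≤-anyRoot : (i : Fin (suc w)) → ZeroForcingNumber≤ (PathHProdSingleton (suc w) h i) h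
ZeroForcingNumber≤-anyRoot {w} {h} i =
  firstColumn w h , ≤-reflexive (trans (length-map _ (allFin h)) (length-tabulate _)) ,
  firstColumn-zeroForcing i

lastColumnEvenRows : (w h : ℕ) → List (Fin (suc w) × Fin h)
lastColumnEvenRows w h = map (fromℕ w ,_) (evenFins h)

_<ₗₑₓ_ : ℕ × ℕ → ℕ × ℕ → Set
_<ₗₑₓ_ = ×-Lex _≡_ _<_ _<_

-- Even rows come first, each swept from the last column; the odd rows follow
-- in increasing order, each swept from the first column.
sweepRank : Fin (suc w) × Fin h → ℕ × ℕ
sweepRank (x , y) with parity (toℕ y)
... | 0ℙ = 0 , toℕ (opposite x)
... | 1ℙ = suc (toℕ y) , toℕ x

module _ {a b : Fin (suc w)} where

  evenRow-earlier : (y : Fin h) → parity (toℕ y) ≡ 0ℙ → toℕ a < toℕ b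
    → sweepRank (b , y) <ₗₑₓ sweepRank (a , y)
  evenRow-earlier _ even a<b rewrite even = inj₂ (refl , opposite-reverses-< a<b)

  oddRow-earlier : (y : Fin h) → parity (toℕ y) ≡ 1ℙ → toℕ a < toℕ b
    → sweepRank (a , y) <ₗₑₓ sweepRank (b , y)
  oddRow-earlier _ odd a<b rewrite odd = inj₂ (refl , a<b)

  evenRow-before-oddRow : (y₁ y₂ : Fin h) → parity (toℕ y₁) ≡ 0ℙ → parity (toℕ y₂) ≡ 1ℙ
    → sweepRank (a , y₁) <ₗₑₓ sweepRank (b , y₂)
  evenRow-before-oddRow _ _ even odd rewrite even | odd = inj₁ z<s

  lowerRow-before-oddRow : (y₁ y₂ : Fin h) → toℕ y₁ < toℕ y₂ → parity (toℕ y₂) ≡ 1ℙ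
    → sweepRank (a , y₁) <ₗₑₓ sweepRank (b , y₂)
  lowerRow-before-oddRow y₁ _ y₁<y₂ odd rewrite odd with parity (toℕ y₁)
  ... | 0ℙ = inj₁ z<s
  ... | 1ℙ = inj₁ (s<s y₁<y₂)

SweepScheduled : Fin (suc w) × Fin h → Set
SweepScheduled {w} {h} v =
  v ∈ lastColumnEvenRows w h ⊎ EarlierForce _<ₗₑₓ_ (PathHProdSingleton (suc w) h zero) sweepRank v

evenRow-scheduled : (x : Fin (suc w)) (y : Fin h) → parity (toℕ y) ≡ 0ℙ → SweepScheduled (x , y)
evenRow-scheduled x y even with fromℕ-or-inject₁ x
... | inj₁ refl = inj₁ (∈-map⁺ _ (∈-evenFins y even))
... | inj₂ (c , refl) = inj₂ record
  { forcer         = suc c , y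
  ; forcer-adj     = inj₂ (refl , PathAdj-sym (PathAdj-inject₁-suc c))
  ; forcer-earlier = evenRow-earlier y even (inject₁<suc c)
  ; others-earlier = others
  }
  where
  others : ∀ v → PathHProdSingleton _ _ zero (suc c , y) v
    → v ≡ (inject₁ c , y) ⊎ sweepRank v <ₗₑₓ sweepRank (inject₁ c , y)
  others _ (inj₁ (_ , () , _))
  others _ (inj₂ (refl , c+1~b)) =
    ⊎-map (cong (_, y)) (λ c+1<b → evenRow-earlier y even (<-trans (inject₁<suc c) c+1<b))
      (PathAdj-suc c+1~b)

oddRow-scheduled : (x : Fin (suc w)) (y : Fin h) → parity (toℕ y) ≡ 1ℙ → SweepScheduled (x , y)
oddRow-scheduled x zero ()
oddRow-scheduled zero (suc y) odd = inj₂ record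
  { forcer         = zero , inject₁ y
  ; forcer-adj     = inj₁ (refl , refl , PathAdj-inject₁-suc y)
  ; forcer-earlier = evenRow-before-oddRow (inject₁ y) (suc y) below-even odd
  ; others-earlier = others
  }
  where
  below-even : parity (toℕ (inject₁ y)) ≡ 0ℙ
  below-even = trans (cong parity (toℕ-inject₁ y)) (suc-odd⇒even (toℕ y) odd)
  others : ∀ v → PathHProdSingleton _ _ zero (zero , inject₁ y) v
    → v ≡ (zero , suc y) ⊎ sweepRank v <ₗₑₓ sweepRank (zero , suc y)
  others (_ , y₂) (inj₁ (refl , _ , y~y₂)) =
    ⊎-map (cong (zero ,_)) (λ y₂<y → lowerRow-before-oddRow y₂ (suc y) (<-trans y₂<y (inject₁<suc y)) odd)
      (PathAdj-inject₁ y~y₂)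
  others _ (inj₂ (refl , _)) = inj₂ (evenRow-before-oddRow (inject₁ y) (suc y) below-even odd)
oddRow-scheduled (suc c) y odd = inj₂ record
  { forcer         = inject₁ c , y
  ; forcer-adj     = inj₂ (refl , PathAdj-inject₁-suc c)
  ; forcer-earlier = oddRow-earlier y odd (inject₁<suc c)
  ; others-earlier = others
  }
  where
  others : ∀ v → PathHProdSingleton _ _ zero (inject₁ c , y) v
    → v ≡ (suc c , y) ⊎ sweepRank v <ₗₑₓ sweepRank (suc c , y)
  others (_ , y₂) (inj₁ (refl , _ , inj₁ y₂≡y+1)) =
    inj₂ (evenRow-before-oddRow y₂ y (trans (cong parity y₂≡y+1) (odd⇒suc-even (toℕ y) odd)) odd)
  others (_ , y₂) (inj₁ (refl , _ , inj₂ y≡y₂+1)) =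
    inj₂ (lowerRow-before-oddRow y₂ y (≤-reflexive (sym y≡y₂+1)) odd)
  others _ (inj₂ (refl , c~b)) =
    ⊎-map (cong (_, y)) (λ b<c → oddRow-earlier y odd (<-trans b<c (inject₁<suc c)))
      (PathAdj-inject₁ c~b)

lastColumnEvenRows-zeroForcing : IsZeroForcingSet (PathHProdSingleton (suc w) h zero) (lastColumnEvenRows w h)
lastColumnEvenRows-zeroForcing =
  zeroForcingSet-byRank (×-wellFounded <-wellFounded <-wellFounded) sweepRank scheduled
  where
  scheduled : (v : Fin (suc _) × Fin _) → SweepScheduled v
  scheduled (x , y) with parity (toℕ y) in p
  ... | 0ℙ = evenRow-scheduled x y p
  ... | 1ℙ = oddRow-scheduled x y p

ZeroForcingNumber≤-firstRoot : ZeroForcingNumber≤ (PathHProdSingleton (suc w) h zero) ⌈ h /2⌉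
ZeroForcingNumber≤-firstRoot {w} {h} =
  lastColumnEvenRows w h , ≤-reflexive (trans (length-map _ (evenFins h)) (length-evenFins h)) ,
  lastColumnEvenRows-zeroForcing

ZeroForcingNumber≤-lastRoot : ZeroForcingNumber≤ (PathHProdSingleton (suc w) h (fromℕ w)) ⌈ h /2⌉
ZeroForcingNumber≤-lastRoot {w} {h} =
  ZeroForcingNumber≤-iso reflect reflect reflect-involutive reflect-involutive
    reflect-adj reflect-adj⁻¹ ZeroForcingNumber≤-firstRoot
  where
  First Last : Fin (suc w) × Fin h → Fin (suc w) × Fin h → Set
  First = PathHProdSingleton (suc w) h zero
  Last = PathHProdSingleton (suc w) h (fromℕ w)
  reflect : Fin (suc w) × Fin h → Fin (suc w) × Fin h
  reflect = map₁ opposite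
  reflect-involutive : ∀ v → reflect (reflect v) ≡ v
  reflect-involutive (x , y) = cong (_, y) (opposite-involutive x)
  reflect-adj : ∀ {u v} → First u v → Last (reflect u) (reflect v)
  reflect-adj = HProdAdj-map₁ {W = PathAdj (suc w)} {_≡ zero} {_≡ fromℕ w} {PathAdj h}
    opposite PathAdj-opposite (cong opposite)
  reflect-adj⁻¹ : ∀ {u v} → Last u v → First (reflect u) (reflect v)
  reflect-adj⁻¹ = HProdAdj-map₁ {W = PathAdj (suc w)} {_≡ fromℕ w} {_≡ zero} {PathAdj h}
    opposite PathAdj-opposite
    λ x≡last → trans (cong opposite x≡last) (opposite-involutive zero)

mainTheorem1 : (w h : ℕ) → 1 ≤ w → 1 ≤ h →
    ((i : Fin w) → (toℕ i ≡ 0 ⊎ toℕ i ≡ w ∸ 1) →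
    ZeroForcingNumber≤ (PathHProdSingleton w h i) ⌈ h /2⌉)
    × ((i : Fin w) → toℕ i ≢ 0 → toℕ i ≢ w ∸ 1 →
    ZeroForcingNumber≤ (PathHProdSingleton w h i) h)
mainTheorem1 zero _ () _
mainTheorem1 (suc w) h _ _ = endRoot , λ i _ _ → ZeroForcingNumber≤-anyRoot i
  where
  endRoot : (i : Fin (suc w)) → toℕ i ≡ 0 ⊎ toℕ i ≡ w →
    ZeroForcingNumber≤ (PathHProdSingleton (suc w) h i) ⌈ h /2⌉
  endRoot i (inj₁ i≡0) rewrite toℕ-injective {i = i} {zero} i≡0 = ZeroForcingNumber≤-firstRoot
  endRoot i (inj₂ i≡w) rewrite toℕ-injective {i = i} {fromℕ w} (trans i≡w (sym (toℕ-fromℕ w))) =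
    ZeroForcingNumber≤-lastRoot
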